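{- Let $G$ be a simple graph and let $u,v$ be non-adjacent vertices of $G$. Then $$w(G,x)=w(G+uv,x)+(1-x)\,w(G\cdot uv,x).$$
   Context: For a simple graph $H$ of order $n$, define $w_i(H)$ by $\chi(H,x)=\sum_{0\le i\le n}w_i(H)\binom{x+n-i}{n}$, where $\chi(H,x)$ is the chromatic polynomial, and $w(H,x)=\sum_{0\le i\le n}w_i(H)x^i$. $G+uv$ is obtained from $G$ by adding the edge $uv$; $G\cdot uv$ is the simple graph obtained from $G$ by identifying $u$ and $v$ (removing multiple edges). -}

module Defs where

open import Data.Bool using (Bool; true; false; _∧_; _∨_; not; if_then_else_)
open import Data.Bool.Properties using (∨-comm)
open import Data.Nat using (ℕ; zero; suc; _+_; _∸_)
open import Data.Nat.Combinatorics using (_C_)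
open import Data.Fin using (Fin; zero; suc; toℕ; punchIn; punchOut; _≟_)
open import Data.Integer using (ℤ; +_; _-_) renaming (_+_ to _+ℤ_; _*_ to _*ℤ_)
open import Data.List using (List; []; _∷_; length; filter; concatMap; map; allFin)
open import Data.Empty using (⊥-elim)
open import Relation.Nullary using (yes; no; ¬_)
open import Relation.Nullary.Decidable using (⌊_⌋)
open import Relation.Binary.PropositionalEquality using (_≡_; _≢_; refl; sym)

record Graph (n : ℕ) : Set where
  field
    adj    : Fin n → Fin n → Bool
    adj-sym    : ∀ i j → adj i j ≡ adj j i
    adj-irrefl : ∀ i → adj i i ≡ false
open Graph public

_==_ : ∀ {n} → Fin n → Fin n → Bool
a == b = ⌊ a ≟ b ⌋

simplify : ∀ {n} → (Fin n → Fin n → Bool) → Graph n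
simplify {n} r = record { adj = A ; adj-sym = S ; adj-irrefl = I }
  where
  A : Fin n → Fin n → Bool
  A a b with a ≟ b
  ... | yes _ = false
  ... | no  _ = r a b ∨ r b a
  S : ∀ i j → A i j ≡ A j i
  S i j with i ≟ j | j ≟ i
  ... | yes _ | yes _ = refl
  ... | yes p | no q = ⊥-elim (q (sym p))
  ... | no q | yes p = ⊥-elim (q (sym p))
  ... | no _ | no _ = ∨-comm (r i j) (r j i)
  I : ∀ i → A i i ≡ false
  I i with i ≟ i
  ... | yes _ = refl
  ... | no q = ⊥-elim (q refl)

addEdge : ∀ {n} → Graph n → Fin n → Fin n → Graph n
addEdge G u v = simplify (λ a b → adj G a b ∨ ((a == u) ∧ (b == v)))

-- Vertices of G · uv are Fin m, where the vertex a corresponds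
-- to the vertex punchIn v a of G, and the merged vertex is punchOut (u ≠ v).
contract : ∀ {m} → Graph (suc m) → (u v : Fin (suc m)) → u ≢ v → Graph m
contract G u v u≢v =
  simplify (λ a b → adj G (punchIn v a) (punchIn v b)
                    ∨ ((a == uv) ∧ adj G v (punchIn v b)))
  where
  uv = punchOut {i = v} {j = u} (λ e → u≢v (sym e))

allMaps : (n x : ℕ) → List (Fin n → Fin x)
allMaps zero    x = (λ ()) ∷ []
allMaps (suc n) x =
  concatMap (λ c → map (λ f → λ { zero → c ; (suc i) → f i }) (allMaps n x)) (allFin x)

allB : ∀ {A : Set} → (A → Bool) → List A → Bool
allB p []       = true
allB p (a ∷ as) = p a ∧ allB p as

isProper : ∀ {n x} → Graph n → (Fin n → Fin x) → Bool
isProper {n} G c =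
  allB (λ i → allB (λ j → not (adj G i j ∧ (c i == c j))) (allFin n)) (allFin n)

chromatic : ∀ {n} → Graph n → ℕ → ℕ
chromatic {n} G x = length (filter (λ c → isProper G c ≡? true) (allMaps n x))
  where
  open import Data.Bool.Properties using () renaming (_≟_ to _≡?_)

ΣFin : (k : ℕ) → (Fin k → ℤ) → ℤ
ΣFin zero    f = + 0
ΣFin (suc k) f = f zero +ℤ ΣFin k (λ i → f (suc i))

-- Since both sides are polynomials in x
-- of degree ≤ n, equality for all natural x is equality of polynomials.
IsW : ∀ {n} → Graph n → (Fin (suc n) → ℤ) → Set
IsW {n} H w = ∀ (x : ℕ) →
  + chromatic H x ≡ ΣFin (suc n) (λ i → w i *ℤ + ((x + n ∸ toℕ i) C n))

Poly : Set
Poly = ℕ → ℤ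

wPoly : ∀ {n} → (Fin (suc n) → ℤ) → Poly
wPoly {n} w i = go n w i
  where
  go : (k : ℕ) → (Fin (suc k) → ℤ) → ℕ → ℤ
  go k       f zero          = f zero
  go zero    f (suc i)       = + 0
  go (suc k) f (suc i)       = go k (λ j → f (suc j)) i

_⊕_ : Poly → Poly → Poly
(p ⊕ q) i = p i +ℤ q i

oneMinusX* : Poly → Poly
oneMinusX* p zero    = p zero
oneMinusX* p (suc i) = p (suc i) - p i

-- A proper colouring of G either separates u and v, and is then a proper colouring of G + uv, or gives
-- them the same colour, and then amounts to a proper colouring of G · uv; hence
-- χ(G, x) = χ(G + uv, x) + χ(G · uv, x) for every natural x.  G · uv has one vertex fewer, and by
-- Pascal's rule C(y + 1, n + 1) − C(y, n + 1) = C(y, n) rewriting Σᵢ aᵢ C(x + n − i, n) in the basis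
-- C(x + (n + 1) − i, n + 1) multiplies the coefficient sequence a by 1 − x.  Finally, evaluating at
-- x = k kills the basis elements with i > k and gives 1 at i = k, so the basis is triangular and the
-- coefficients of a polynomial of degree ≤ n are determined by its values at the naturals.

module Submission where

open import Defs
open import Data.Nat using (ℕ; suc)
open import Data.Fin using (Fin)
open import Data.Bool using (false)
open import Data.Integer using (ℤ)
open import Relation.Binary.PropositionalEquality using (_≡_; _≢_)

open import Data.Nat using (zero; _≤_; _<_; _∸_; _≤?_)
import Data.Nat.Properties as ℕ
open import Data.Fin using (zero; suc; toℕ; fromℕ<; punchIn; punchOut; _≟_)
import Data.Fin.Properties as Fin
open import Data.Empty using (⊥; ⊥-elim)
open import Function using (_∘_)
open import Relation.Nullary using (yes; no)
open import Relation.Binary.PropositionalEquality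
  using (_≗_; refl; sym; trans; cong; cong₂; subst; module ≡-Reasoning)
open import Algebra.Bundles using (CommutativeMonoid)

module CommutativeMonoidSum {a ℓ} (M : CommutativeMonoid a ℓ) where
  open CommutativeMonoid M using (Carrier; _≈_; _∙_; ε; ∙-congˡ; identityʳ; setoid)
  open import Algebra.Properties.CommutativeMonoid.Sum M using (sum; sum-remove; sum-cong-≋; sum-replicate-zero)
  open import Data.Vec.Functional using (replicate)
  open import Relation.Binary.Reasoning.Setoid setoid

  sum-single : ∀ {n} (t : Fin n → Carrier) i → (∀ j → j ≢ i → t j ≈ ε) → sum t ≈ t i
  sum-single {suc n} t i rest-vanishes = begin
    sum t                     ≈⟨ sum-remove t ⟩
    t i ∙ sum (t ∘ punchIn i) ≈⟨ ∙-congˡ (sum-cong-≋ λ j → rest-vanishes _ (Fin.punchInᵢ≢i i j)) ⟩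
    t i ∙ sum (replicate n ε) ≈⟨ ∙-congˡ (sum-replicate-zero n) ⟩
    t i ∙ ε                   ≈⟨ identityʳ (t i) ⟩
    t i                       ∎

module BinomialBasis where
  open import Data.Nat as ℕ using ()
  open import Data.Nat.Combinatorics using (_C_; nCk+nC[k+1]≡[n+1]C[k+1]; nCn≡1)
  open import Data.Nat.Combinatorics.Specification using (k>n⇒nCk≡0)
  open import Data.Nat.Induction using (<-rec)
  open import Data.Integer using (+_; 0ℤ; _+_; _-_; _*_)
  import Data.Integer.Properties as ℤ
  open import Data.Integer.Tactic.RingSolver using (solve-∀)
  open import Relation.Binary.Definitions using (tri<; tri≈; tri>)
  open import Algebra.Properties.Ring ℤ.+-*-ring using (x[y-z]≈xy-xz; [y-z]x≈yx-zx)
  open import Algebra.Properties.Semiring.Sum ℤ.+-*-semiring using (sum; sum-syntax; sum-cong-≗; ∑-distrib-+)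
  open CommutativeMonoidSum ℤ.+-0-commutativeMonoid using (sum-single)
  open ≡-Reasoning

  ∑< : ℕ → (ℕ → ℤ) → ℤ
  ∑< k F = ∑[ i < k ] F (toℕ i)

  ∑<-cong : ∀ k {F G : ℕ → ℤ} → (∀ i → i < k → F i ≡ G i) → ∑< k F ≡ ∑< k G
  ∑<-cong k F≗G = sum-cong-≗ {k} λ i → F≗G (toℕ i) (Fin.toℕ<n i)

  ∑<-distrib-+ : ∀ k (F G : ℕ → ℤ) → ∑< k (λ i → F i + G i) ≡ ∑< k F + ∑< k G
  ∑<-distrib-+ k F G = ∑-distrib-+ {k} (F ∘ toℕ) (G ∘ toℕ)

  ∑<-distrib-minus : ∀ k (F G : ℕ → ℤ) → ∑< k (λ i → F i - G i) ≡ ∑< k F - ∑< k G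
  ∑<-distrib-minus zero    F G = refl
  ∑<-distrib-minus (suc k) F G = trans (cong (_+_ (F 0 - G 0)) (∑<-distrib-minus k (F ∘ suc) (G ∘ suc)))
                                   (interchange (F 0) (G 0) (∑< k (F ∘ suc)) (∑< k (G ∘ suc)))
    where
    interchange : ∀ a b c d → (a - b) + (c - d) ≡ (a + c) - (b + d)
    interchange = solve-∀

  ∑<-dropLast : ∀ k (F : ℕ → ℤ) → F k ≡ 0ℤ → ∑< (suc k) F ≡ ∑< k F
  ∑<-dropLast zero    F F0≡0 = cong (_+ 0ℤ) F0≡0
  ∑<-dropLast (suc k) F Fk≡0 = cong (_+_ (F 0)) (∑<-dropLast k (F ∘ suc) Fk≡0)

  HasDegree≤ : ℕ → Poly → Set
  HasDegree≤ n p = ∀ i → n < i → p i ≡ 0ℤ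

  _⊖_ : Poly → Poly → Poly
  (p ⊖ q) i = p i - q i

  binomialBasis : ℕ → ℕ → ℕ → ℤ
  binomialBasis n x i = + ((x ℕ.+ n ∸ i) C n)

  binomialSum : ℕ → Poly → ℕ → ℤ
  binomialSum n a x = ∑< (suc n) (λ i → a i * binomialBasis n x i)

  wPoly-toℕ : ∀ {n} (w : Fin (suc n) → ℤ) i → wPoly w (toℕ i) ≡ w i
  wPoly-toℕ         w zero    = refl
  wPoly-toℕ {suc n} w (suc i) = wPoly-toℕ (w ∘ suc) i

  wPoly-degree : ∀ {n} (w : Fin (suc n) → ℤ) → HasDegree≤ n (wPoly w)
  wPoly-degree {zero}  w (suc i) _           = refl
  wPoly-degree {suc n} w (suc i) (ℕ.s≤s n<i) = wPoly-degree (w ∘ suc) i n<i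

  ⊕-degree : ∀ {n p q} → HasDegree≤ n p → HasDegree≤ n q → HasDegree≤ n (p ⊕ q)
  ⊕-degree deg-p deg-q i n<i = cong₂ _+_ (deg-p i n<i) (deg-q i n<i)

  oneMinusX*-degree : ∀ {n p} → HasDegree≤ n p → HasDegree≤ (suc n) (oneMinusX* p)
  oneMinusX*-degree deg-p (suc i) (ℕ.s≤s n<i) = cong₂ _-_ (deg-p (suc i) (ℕ.m<n⇒m<1+n n<i)) (deg-p i n<i)

  ΣFin≡sum : ∀ {k} (f : Fin k → ℤ) → ΣFin k f ≡ sum f
  ΣFin≡sum {zero}  f = refl
  ΣFin≡sum {suc k} f = cong (_+_ (f zero)) (ΣFin≡sum (f ∘ suc))

  IsW⇒binomialSum : ∀ {n} (H : Graph n) w → IsW H w →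
    ∀ x → + chromatic H x ≡ binomialSum n (wPoly w) x
  IsW⇒binomialSum {n} H w isW x = begin
    + chromatic H x                          ≡⟨ isW x ⟩
    ΣFin (suc n) (λ i → w i * basis (toℕ i)) ≡⟨ ΣFin≡sum (λ i → w i * basis (toℕ i)) ⟩
    ∑[ i < suc n ] (w i * basis (toℕ i))
      ≡⟨ sum-cong-≗ {suc n} (λ i → cong (_* basis (toℕ i)) (sym (wPoly-toℕ w i))) ⟩
    binomialSum n (wPoly w) x                ∎
    where
    basis : ℕ → ℤ
    basis = binomialBasis n x

  binomialSum-⊕ : ∀ n p q x → binomialSum n (p ⊕ q) x ≡ binomialSum n p x + binomialSum n q x
  binomialSum-⊕ n p q x = trans (∑<-cong (suc n) λ i _ → ℤ.*-distribʳ-+ (basis i) (p i) (q i))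
                                (∑<-distrib-+ (suc n) (λ i → p i * basis i) (λ i → q i * basis i))
    where
    basis : ℕ → ℤ
    basis = binomialBasis n x

  binomialSum-⊖ : ∀ n p q x → binomialSum n (p ⊖ q) x ≡ binomialSum n p x - binomialSum n q x
  binomialSum-⊖ n p q x = trans (∑<-cong (suc n) λ i _ → [y-z]x≈yx-zx (basis i) (p i) (q i))
                                (∑<-distrib-minus (suc n) (λ i → p i * basis i) (λ i → q i * basis i))
    where
    basis : ℕ → ℤ
    basis = binomialBasis n x

  pascal-shift : ∀ x m i → i ≤ m →
    (x ℕ.+ suc m ∸ i) C suc m ≡ (x ℕ.+ m ∸ i) C m ℕ.+ (x ℕ.+ suc m ∸ suc i) C suc m
  pascal-shift x m i i≤m rewrite ℕ.+-suc x m | ℕ.+-∸-assoc 1 (ℕ.≤-trans i≤m (ℕ.m≤n+m m x)) =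
    sym (nCk+nC[k+1]≡[n+1]C[k+1] (x ℕ.+ m ∸ i) m)

  binomialBasis-difference : ∀ x m i → i ≤ m →
    binomialBasis (suc m) x i - binomialBasis (suc m) x (suc i) ≡ binomialBasis m x i
  binomialBasis-difference x m i i≤m = begin
    + ((x ℕ.+ suc m ∸ i) C suc m) - + c ≡⟨ cong (λ n → + n - + c) (pascal-shift x m i i≤m) ⟩
    + (b ℕ.+ c) - + c                   ≡⟨ cong (_- + c) (ℤ.pos-+ b c) ⟩
    (+ b + + c) - + c                   ≡⟨ add-sub-cancel (+ b) (+ c) ⟩
    + b                                 ∎
    where
    b c : ℕ
    b = (x ℕ.+ m ∸ i) C m
    c = (x ℕ.+ suc m ∸ suc i) C suc m
    add-sub-cancel : ∀ y z → (y + z) - z ≡ y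
    add-sub-cancel = solve-∀

  binomialSum-oneMinusX* : ∀ {m} p → HasDegree≤ m p →
    ∀ x → binomialSum (suc m) (oneMinusX* p) x ≡ binomialSum m p x
  binomialSum-oneMinusX* {m} p deg-p x = begin
    binomialSum (suc m) (oneMinusX* p) x
      ≡⟨⟩
    p 0 * g 0 + ∑< (suc m) (λ i → (p (suc i) - p i) * g (suc i))
      ≡⟨ cong (_+_ (p 0 * g 0))
              (trans (∑<-cong (suc m) λ i _ → [y-z]x≈yx-zx (g (suc i)) (p (suc i)) (p i))
                     (∑<-distrib-minus (suc m) (λ i → p (suc i) * g (suc i)) (λ i → p i * g (suc i)))) ⟩
    p 0 * g 0 + (∑< (suc m) (λ i → p (suc i) * g (suc i)) - ∑< (suc m) (λ i → p i * g (suc i)))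
      ≡⟨ sym (ℤ.+-assoc (p 0 * g 0) _ _) ⟩
    ∑< (suc (suc m)) (λ i → p i * g i) - ∑< (suc m) (λ i → p i * g (suc i))
      ≡⟨ cong (_- ∑< (suc m) (λ i → p i * g (suc i)))
              (∑<-dropLast (suc m) (λ i → p i * g i) (cong (_* g (suc m)) (deg-p (suc m) (ℕ.n<1+n m)))) ⟩
    ∑< (suc m) (λ i → p i * g i) - ∑< (suc m) (λ i → p i * g (suc i))
      ≡⟨ sym (∑<-distrib-minus (suc m) (λ i → p i * g i) (λ i → p i * g (suc i))) ⟩
    ∑< (suc m) (λ i → p i * g i - p i * g (suc i))
      ≡⟨ ∑<-cong (suc m) (λ i i<1+m → trans (sym (x[y-z]≈xy-xz (p i) (g i) (g (suc i))))
                                            (cong (p i *_) (binomialBasis-difference x m i (ℕ.≤-pred i<1+m)))) ⟩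
    binomialSum m p x ∎
    where
    g : ℕ → ℤ
    g = binomialBasis (suc m) x

  binomialBasis-vanishes : ∀ n k i → k < i → i ≤ n → binomialBasis n k i ≡ 0ℤ
  binomialBasis-vanishes n k i k<i i≤n =
    cong (λ t → + t) (k>n⇒nCk≡0 (subst (k ℕ.+ n ∸ i <_) (ℕ.m+n∸m≡n k n) top<n))
    where
    top<n : k ℕ.+ n ∸ i < k ℕ.+ n ∸ k
    top<n = ℕ.∸-monoʳ-< k<i (ℕ.≤-trans i≤n (ℕ.m≤n+m n k))

  binomialBasis-diagonal : ∀ n k → binomialBasis n k k ≡ + 1
  binomialBasis-diagonal n k = cong (λ t → + t) (trans (cong (_C n) (ℕ.m+n∸m≡n k n)) (nCn≡1 n))

  binomialSum-at : ∀ {n} a k → k ≤ n → (∀ j → j < k → a j ≡ 0ℤ) → binomialSum n a k ≡ a k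
  binomialSum-at {n} a k k≤n below = begin
    binomialSum n a k         ≡⟨ sum-single (term ∘ toℕ) i other-terms ⟩
    term (toℕ i)              ≡⟨ cong term toℕ-i ⟩
    a k * binomialBasis n k k ≡⟨ cong (a k *_) (binomialBasis-diagonal n k) ⟩
    a k * + 1                 ≡⟨ ℤ.*-identityʳ (a k) ⟩
    a k                       ∎
    where
    term : ℕ → ℤ
    term j = a j * binomialBasis n k j
    i : Fin (suc n)
    i = fromℕ< (ℕ.s≤s k≤n)
    toℕ-i : toℕ i ≡ k
    toℕ-i = Fin.toℕ-fromℕ< (ℕ.s≤s k≤n)
    other-terms : ∀ j → j ≢ i → term (toℕ j) ≡ 0ℤ
    other-terms j j≢i with ℕ.<-cmp (toℕ j) k
    ... | tri< j<k _ _ = cong (_* binomialBasis n k (toℕ j)) (below (toℕ j) j<k)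
    ... | tri≈ _ j≡k _ = ⊥-elim (j≢i (Fin.toℕ-injective (trans j≡k (sym toℕ-i))))
    ... | tri> _ _ k<j = trans (cong (a (toℕ j) *_) (binomialBasis-vanishes n k (toℕ j) k<j (Fin.toℕ≤pred[n] j)))
                               (ℤ.*-zeroʳ (a (toℕ j)))

  binomialSum-kernel : ∀ {n} a → (∀ x → binomialSum n a x ≡ 0ℤ) → ∀ k → k ≤ n → a k ≡ 0ℤ
  binomialSum-kernel {n} a vanishes = <-rec (λ k → k ≤ n → a k ≡ 0ℤ) λ k below k≤n →
    trans (sym (binomialSum-at a k k≤n λ j j<k → below j<k (ℕ.≤-trans (ℕ.<⇒≤ j<k) k≤n))) (vanishes k)

  binomialSum-injective : ∀ {n p q} → HasDegree≤ n p → HasDegree≤ n q →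
    (∀ x → binomialSum n p x ≡ binomialSum n q x) → ∀ i → p i ≡ q i
  binomialSum-injective {n} {p} {q} deg-p deg-q same i with i ≤? n
  ... | yes i≤n = ℤ.i-j≡0⇒i≡j (p i) (q i) (binomialSum-kernel (p ⊖ q) difference-vanishes i i≤n)
    where
    difference-vanishes : ∀ x → binomialSum n (p ⊖ q) x ≡ 0ℤ
    difference-vanishes x = trans (binomialSum-⊖ n p q x) (ℤ.i≡j⇒i-j≡0 (same x))
  ... | no  i≰n = trans (deg-p i (ℕ.≰⇒> i≰n)) (sym (deg-q i (ℕ.≰⇒> i≰n)))

  coefficients-of-mixed-sum : ∀ {m p q r} →
    HasDegree≤ (suc m) p → HasDegree≤ (suc m) q → HasDegree≤ m r →
    (∀ x → binomialSum (suc m) p x ≡ binomialSum (suc m) q x + binomialSum m r x) →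
    ∀ i → p i ≡ (q ⊕ oneMinusX* r) i
  coefficients-of-mixed-sum {m} {p} {q} {r} deg-p deg-q deg-r expansions-add =
    binomialSum-injective deg-p (⊕-degree deg-q (oneMinusX*-degree deg-r)) λ x → begin
      binomialSum (suc m) p x                                        ≡⟨ expansions-add x ⟩
      binomialSum (suc m) q x + binomialSum m r x
        ≡⟨ cong (_+_ (binomialSum (suc m) q x)) (sym (binomialSum-oneMinusX* r deg-r x)) ⟩
      binomialSum (suc m) q x + binomialSum (suc m) (oneMinusX* r) x
        ≡⟨ sym (binomialSum-⊕ (suc m) q (oneMinusX* r) x) ⟩
      binomialSum (suc m) (q ⊕ oneMinusX* r) x                       ∎

module Colourings where
  open import Data.Bool using (Bool; true; T; not; _∧_; _∨_; if_then_else_)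
  open import Data.Bool.Properties using (T-∧; T-∨; ∧-identityʳ; ∧-zeroʳ) renaming (_≟_ to _≟ᵇ_)
  open import Data.Nat using (_+_)
  open import Data.List as List using (List; []; _∷_; length; filter; concatMap; allFin; tabulate)
  import Data.List.Properties as List
  open import Data.Nat.ListAction using (sum)
  open import Data.Nat.ListAction.Properties using (sum-++)
  open import Data.List.Relation.Unary.All as All using (All; []; _∷_)
  import Data.List.Relation.Unary.All.Properties as All
  open import Data.Vec.Functional using (insertAt)
  open import Data.Vec.Functional.Properties using (insertAt-lookup; insertAt-punchIn)
  open import Data.Product using (_×_; _,_; proj₂)
  open import Data.Product.Function.NonDependent.Propositional using (_×-⇔_)
  open import Data.Sum using (inj₁; inj₂; [_,_]′)
  open import Data.Unit using (tt)
  open import Function using (_⇔_; mk⇔; Equivalence)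
  import Function.Properties.Equivalence as ⇔
  open import Relation.Nullary using (¬_)
  open import Relation.Nullary.Decidable using (toWitness; fromWitness; isYes≗does; dec-true; dec-false)
  open import Algebra.Properties.Semiring.Sum ℕ.+-*-semiring
    using (sum-syntax; sum-cong-≗; ∑-distrib-+; ∑-comm)
  open CommutativeMonoidSum ℕ.+-0-commutativeMonoid using (sum-single)
  open Equivalence using (to; from)

  T-injective : ∀ {a b} → (T a ⇔ T b) → a ≡ b
  T-injective {false} {false} _   = refl
  T-injective {false} {true}  a⇔b = ⊥-elim (from a⇔b tt)
  T-injective {true}  {false} a⇔b = ⊥-elim (to a⇔b tt)
  T-injective {true}  {true}  _   = refl

  T-== : ∀ {n} {a b : Fin n} → T (a == b) ⇔ a ≡ b
  T-== = mk⇔ toWitness fromWitness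

  ==-refl : ∀ {n} (a : Fin n) → (a == a) ≡ true
  ==-refl a = trans (isYes≗does (a ≟ a)) (dec-true (a ≟ a) refl)

  ==-≢ : ∀ {n} {a b : Fin n} → a ≢ b → (a == b) ≡ false
  ==-≢ {a = a} {b} a≢b = trans (isYes≗does (a ≟ b)) (dec-false (a ≟ b) a≢b)

  T-not : ∀ {b} → T (not b) ⇔ (¬ T b)
  T-not {true}  = mk⇔ (λ ()) (λ ¬t → ¬t tt)
  T-not {false} = mk⇔ (λ _ ()) (λ _ → tt)

  T-allB : ∀ {A : Set} {p : A → Bool} xs → T (allB p xs) ⇔ All (T ∘ p) xs
  T-allB []       = mk⇔ (λ _ → []) (λ _ → tt)
  T-allB (x ∷ xs) = mk⇔
    (λ t → let px , pxs = to T-∧ t in px ∷ to (T-allB xs) pxs)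
    (λ { (px ∷ pxs) → from T-∧ (px , from (T-allB xs) pxs) })

  T-allB-allFin : ∀ {n} {p : Fin n → Bool} → T (allB p (allFin n)) ⇔ (∀ i → T (p i))
  T-allB-allFin {n} = mk⇔ (All.tabulate⁻ ∘ to (T-allB (allFin n))) (from (T-allB (allFin n)) ∘ All.tabulate⁺)

  Proper : ∀ {n x} → Graph n → (Fin n → Fin x) → Set
  Proper H c = ∀ {i j} → T (adj H i j) → c i ≢ c j

  adj⇒≢ : ∀ {n} (H : Graph n) {i j} → T (adj H i j) → i ≢ j
  adj⇒≢ H {i} i~j refl = subst T (adj-irrefl H i) i~j

  T-isProper : ∀ {n x} (H : Graph n) (c : Fin n → Fin x) → T (isProper H c) ⇔ Proper H c
  T-isProper {n} H c = mk⇔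
    (λ t {i} {j} i~j ci≡cj →
       to T-not (to T-allB-allFin (to (T-allB-allFin {p = row}) t i) j) (from T-∧ (i~j , from T-== ci≡cj)))
    (λ P → from (T-allB-allFin {p = row}) λ i → from T-allB-allFin λ j →
       from T-not λ t → let i~j , ci=cj = to T-∧ t in P {i} {j} i~j (to T-== ci=cj))
    where
    row : Fin n → Bool
    row i = allB (λ j → not (adj H i j ∧ (c i == c j))) (allFin n)

  Proper-resp-≗ : ∀ {n x} (H : Graph n) {c d : Fin n → Fin x} → c ≗ d → Proper H c → Proper H d
  Proper-resp-≗ H c≗d P i~j di≡dj = P i~j (trans (c≗d _) (trans di≡dj (sym (c≗d _))))

  isProper-resp-≗ : ∀ {n x} (H : Graph n) {c d : Fin n → Fin x} → c ≗ d → isProper H c ≡ isProper H d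
  isProper-resp-≗ H {c} {d} c≗d = T-injective (mk⇔
    (from (T-isProper H d) ∘ Proper-resp-≗ H c≗d ∘ to (T-isProper H c))
    (from (T-isProper H c) ∘ Proper-resp-≗ H (sym ∘ c≗d) ∘ to (T-isProper H d)))

  T-adj-simplify : ∀ {n} (r : Fin n → Fin n → Bool) {a b} →
    T (adj (simplify r) a b) ⇔ (a ≢ b × T (r a b ∨ r b a))
  T-adj-simplify r {a} {b} with a ≟ b
  ... | yes a≡b = mk⇔ (λ ()) (λ (a≢b , _) → a≢b a≡b)
  ... | no  a≢b = mk⇔ (a≢b ,_) proj₂

  Proper-simplify : ∀ {n x} (r : Fin n → Fin n → Bool) {c : Fin n → Fin x} →
    Proper (simplify r) c ⇔ (∀ {a b} → a ≢ b → T (r a b) → c a ≢ c b)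
  Proper-simplify r = mk⇔
    (λ P {a} {b} a≢b rab → P {a} {b} (from (T-adj-simplify r) (a≢b , from T-∨ (inj₁ rab))))
    (λ S {a} {b} a~b → let a≢b , r∨ = to (T-adj-simplify r) a~b in
       [ S {a} {b} a≢b , (λ rba ca≡cb → S {b} {a} (a≢b ∘ sym) rba (sym ca≡cb)) ]′ (to T-∨ r∨))

  Proper-addEdge : ∀ {n x} (G : Graph n) {u v} → u ≢ v → {c : Fin n → Fin x} →
    Proper (addEdge G u v) c ⇔ (Proper G c × c u ≢ c v)
  Proper-addEdge G {u} {v} u≢v {c} = ⇔.trans (Proper-simplify _) (mk⇔
    (λ S → (λ {i} {j} i~j → S {i} {j} (adj⇒≢ G i~j) (from T-∨ (inj₁ i~j)))
         , S {u} {v} u≢v (from (T-∨ {adj G u v}) (inj₂ (from T-∧ (from (T-== {a = u}) refl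
                                                                , from (T-== {a = v}) refl)))))
    (λ (P , cu≢cv) {a} {b} a≢b r → [ P {a} {b} , new-edge cu≢cv ∘ to T-∧ ]′ (to T-∨ r)))
    where
    new-edge : c u ≢ c v → ∀ {a b} → T (a == u) × T (b == v) → c a ≢ c b
    new-edge cu≢cv (a=u , b=v) with toWitness a=u | toWitness b=v
    ... | refl | refl = cu≢cv

  isProper-addEdge : ∀ {n x} (G : Graph n) {u v} → u ≢ v → (c : Fin n → Fin x) →
    isProper (addEdge G u v) c ≡ isProper G c ∧ not (c u == c v)
  isProper-addEdge G {u} {v} u≢v c = T-injective
    (⇔.trans (T-isProper (addEdge G u v) c)
    (⇔.trans (Proper-addEdge G u≢v)
    (⇔.trans (⇔.sym (T-isProper G c) ×-⇔ ⇔.sym (⇔.trans T-not (mk⇔ (_∘ from T-==) (_∘ to T-==))))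
             (⇔.sym T-∧))))

  data PunchInView {n} (v : Fin (suc n)) : Fin (suc n) → Set where
    at-v     : PunchInView v v
    punchIn⁺ : ∀ a → PunchInView v (punchIn v a)

  punchInView : ∀ {n} (v i : Fin (suc n)) → PunchInView v i
  punchInView v i with v ≟ i
  ... | yes refl = at-v
  ... | no  v≢i  = subst (PunchInView v) (Fin.punchIn-punchOut v≢i) (punchIn⁺ (punchOut v≢i))

  merged : ∀ {m} {u v : Fin (suc m)} → u ≢ v → Fin m
  merged {u = u} {v} u≢v = punchOut {i = v} {j = u} (λ e → u≢v (sym e))

  punchIn-merged : ∀ {m} {u v : Fin (suc m)} (u≢v : u ≢ v) → punchIn v (merged u≢v) ≡ u
  punchIn-merged u≢v = Fin.punchIn-punchOut _

  module _ {m x} (G : Graph (suc m)) {u v : Fin (suc m)} (u≢v : u ≢ v) (u≁v : adj G u v ≡ false)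
           (f : Fin m → Fin x) where

    private
      ū : Fin m
      ū = merged u≢v

      c : Fin (suc m) → Fin x
      c = insertAt f v (f ū)

      c-v : c v ≡ f ū
      c-v = insertAt-lookup f v (f ū)

      c-punchIn : ∀ a → c (punchIn v a) ≡ f a
      c-punchIn = insertAt-punchIn f v (f ū)

      -- Properness of f for contract G u v u≢v, as unfolded by Proper-simplify.
      SeparatesContracted : Set
      SeparatesContracted = ∀ {a b} → a ≢ b →
        T (adj G (punchIn v a) (punchIn v b) ∨ ((a == ū) ∧ adj G v (punchIn v b))) → f a ≢ f b

      separates-v : SeparatesContracted → ∀ b → T (adj G v (punchIn v b)) → c v ≢ c (punchIn v b)
      separates-v S b v~b with b ≟ ū
      ... | yes refl =
        ⊥-elim (subst T (trans (cong (adj G v) (punchIn-merged u≢v)) (trans (adj-sym G v u) u≁v)) v~b)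
      ... | no  b≢ū  = λ cv≡cb → S {ū} {b} (b≢ū ∘ sym)
                         (from (T-∨ {adj G (punchIn v ū) (punchIn v b)})
                               (inj₂ (from T-∧ (from (T-== {a = ū}) refl , v~b))))
                         (trans (sym c-v) (trans cv≡cb (c-punchIn b)))

      lift : SeparatesContracted → Proper G c
      lift S {i} {j} i~j with punchInView v i | punchInView v j
      ... | at-v       | at-v       = ⊥-elim (adj⇒≢ G i~j refl)
      ... | at-v       | punchIn⁺ b = separates-v S b i~j
      ... | punchIn⁺ a | at-v       = separates-v S a (subst T (adj-sym G _ v) i~j) ∘ sym
      ... | punchIn⁺ a | punchIn⁺ b = λ ca≡cb →
        S (λ a≡b → adj⇒≢ G i~j (cong (punchIn v) a≡b)) (from T-∨ (inj₁ i~j))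
          (trans (sym (c-punchIn a)) (trans ca≡cb (c-punchIn b)))

      descend : Proper G c → SeparatesContracted
      descend P {a} {b} _ r fa≡fb = [ old-edge , new-edge ∘ to T-∧ ]′ (to T-∨ r)
        where
        old-edge : T (adj G (punchIn v a) (punchIn v b)) → ⊥
        old-edge a~b = P a~b (trans (c-punchIn a) (trans fa≡fb (sym (c-punchIn b))))
        new-edge : T (a == ū) × T (adj G v (punchIn v b)) → ⊥
        new-edge (a=ū , v~b) =
          P v~b (trans c-v (trans (cong f (sym (toWitness a=ū))) (trans fa≡fb (sym (c-punchIn b)))))

    Proper-contract : Proper (contract G u v u≢v) f ⇔ Proper G (insertAt f v (f (merged u≢v)))
    Proper-contract = ⇔.trans (Proper-simplify _) (mk⇔ lift descend)

    isProper-contract : isProper G (insertAt f v (f (merged u≢v))) ≡ isProper (contract G u v u≢v) f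
    isProper-contract = T-injective
      (⇔.trans (T-isProper G _) (⇔.trans (⇔.sym Proper-contract) (⇔.sym (T-isProper (contract G u v u≢v) f))))

  indicator : Bool → ℕ
  indicator b = if b then 1 else 0

  indicator-split : ∀ a b → indicator a ≡ indicator (a ∧ not b) + indicator (a ∧ b)
  indicator-split true  true  = refl
  indicator-split true  false = refl
  indicator-split false _     = refl

  ∑Maps : (n x : ℕ) → ((Fin n → Fin x) → ℕ) → ℕ
  ∑Maps zero    x h = h (λ ())
  ∑Maps (suc n) x h = ∑[ c < x ] ∑Maps n x (λ f → h (insertAt f zero c))

  -- Without function extensionality, a sum over maps can only be reorganised for summands that
  -- respect pointwise equality of maps.
  Extensional : ∀ {n x} → ((Fin n → Fin x) → ℕ) → Set
  Extensional h = ∀ {f g} → f ≗ g → h f ≡ h g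

  insertAt-zero-extensional : ∀ {n x} {h : (Fin (suc n) → Fin x) → ℕ} → Extensional h →
    ∀ c → Extensional (λ f → h (insertAt f zero c))
  insertAt-zero-extensional ext c f≗g = ext λ { zero → refl ; (suc i) → f≗g i }

  ∑Maps-cong : ∀ n x {h k : (Fin n → Fin x) → ℕ} → (∀ f → h f ≡ k f) →
    ∑Maps n x h ≡ ∑Maps n x k
  ∑Maps-cong zero    x h≗k = h≗k _
  ∑Maps-cong (suc n) x h≗k = sum-cong-≗ {x} λ c → ∑Maps-cong n x λ f → h≗k (insertAt f zero c)

  ∑Maps-+ : ∀ n x (h k : (Fin n → Fin x) → ℕ) →
    ∑Maps n x (λ f → h f + k f) ≡ ∑Maps n x h + ∑Maps n x k
  ∑Maps-+ zero    x h k = refl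
  ∑Maps-+ (suc n) x h k = trans (sum-cong-≗ {x} λ c → ∑Maps-+ n x _ _) (∑-distrib-+ {x} _ _)

  ∑Maps-comm : ∀ n x {y} (F : (Fin n → Fin x) → Fin y → ℕ) →
    ∑Maps n x (λ f → ∑[ c < y ] F f c) ≡ ∑[ c < y ] ∑Maps n x (λ f → F f c)
  ∑Maps-comm zero    x     F = refl
  ∑Maps-comm (suc n) x {y} F =
    trans (sum-cong-≗ {x} λ c₀ → ∑Maps-comm n x (λ f → F (insertAt f zero c₀))) (∑-comm {x} {y} _)

  ∑Maps-insertAt : ∀ n x (v : Fin (suc n)) {h : (Fin (suc n) → Fin x) → ℕ} → Extensional h →
    ∑Maps (suc n) x h ≡ ∑[ c < x ] ∑Maps n x (λ f → h (insertAt f v c))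
  ∑Maps-insertAt n       x zero    ext = refl
  ∑Maps-insertAt (suc n) x (suc v) {h} ext = begin
    ∑[ c₀ < x ] ∑Maps (suc n) x (λ f → h (insertAt f zero c₀))
      ≡⟨ sum-cong-≗ {x} (λ c₀ → ∑Maps-insertAt n x v (insertAt-zero-extensional ext c₀)) ⟩
    ∑[ c₀ < x ] ∑[ c < x ] ∑Maps n x (λ f → h (insertAt (insertAt f v c) zero c₀))
      ≡⟨ ∑-comm {x} {x} _ ⟩
    ∑[ c < x ] ∑[ c₀ < x ] ∑Maps n x (λ f → h (insertAt (insertAt f v c) zero c₀))
      ≡⟨ sum-cong-≗ {x} (λ c → sum-cong-≗ {x} λ c₀ →
           ∑Maps-cong n x λ f → ext (insertAt-swap f c₀ c)) ⟩
    ∑[ c < x ] ∑Maps (suc n) x (λ f → h (insertAt f (suc v) c)) ∎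
    where
    open ≡-Reasoning
    insertAt-swap : ∀ f c₀ c → insertAt (insertAt f v c) zero c₀ ≗ insertAt (insertAt f zero c₀) (suc v) c
    insertAt-swap f c₀ c zero    = refl
    insertAt-swap f c₀ c (suc i) = refl

  length-filter-≡true : ∀ {A : Set} (p : A → Bool) xs →
    length (filter (λ a → p a ≟ᵇ true) xs) ≡ sum (List.map (indicator ∘ p) xs)
  length-filter-≡true p []       = refl
  length-filter-≡true p (a ∷ xs) with p a
  ... | true  = cong suc (length-filter-≡true p xs)
  ... | false = length-filter-≡true p xs

  sum-map-concatMap : ∀ {A B : Set} (h : B → ℕ) (g : A → List B) xs →
    sum (List.map h (concatMap g xs)) ≡ sum (List.map (sum ∘ List.map h ∘ g) xs)
  sum-map-concatMap h g []       = refl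
  sum-map-concatMap h g (a ∷ xs) = begin
    sum (List.map h (g a List.++ concatMap g xs))
      ≡⟨ cong sum (List.map-++ h (g a) (concatMap g xs)) ⟩
    sum (List.map h (g a) List.++ List.map h (concatMap g xs))
      ≡⟨ sum-++ (List.map h (g a)) _ ⟩
    sum (List.map h (g a)) + sum (List.map h (concatMap g xs))
      ≡⟨ cong (sum (List.map h (g a)) +_) (sum-map-concatMap h g xs) ⟩
    sum (List.map (sum ∘ List.map h ∘ g) (a ∷ xs)) ∎
    where open ≡-Reasoning

  sum-tabulate : ∀ {n} (h : Fin n → ℕ) → sum (tabulate h) ≡ ∑[ i < n ] h i
  sum-tabulate {zero}  h = refl
  sum-tabulate {suc n} h = cong (h zero +_) (sum-tabulate (h ∘ suc))

  sum-map-allFin : ∀ {n} (h : Fin n → ℕ) → sum (List.map h (allFin n)) ≡ ∑[ i < n ] h i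
  sum-map-allFin h = trans (cong sum (List.map-tabulate (λ i → i) h)) (sum-tabulate h)

  sum-map-allMaps : ∀ n x {h : (Fin n → Fin x) → ℕ} → Extensional h →
    sum (List.map h (allMaps n x)) ≡ ∑Maps n x h
  sum-map-allMaps zero    x ext = trans (ℕ.+-identityʳ _) (ext λ ())
  sum-map-allMaps (suc n) x {h} ext = unfold-cons _ (λ c f → λ { zero → refl ; (suc i) → refl })
    where
    -- allMaps extends maps by an extended lambda of Defs, only pointwise equal to insertAt f zero c.
    unfold-cons : (cons : Fin x → (Fin n → Fin x) → Fin (suc n) → Fin x) →
      (∀ c f → cons c f ≗ insertAt f zero c) →
      sum (List.map h (concatMap (λ c → List.map (cons c) (allMaps n x)) (allFin x))) ≡ ∑Maps (suc n) x h
    unfold-cons cons cons≗insertAt = begin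
      sum (List.map h (concatMap (λ c → List.map (cons c) (allMaps n x)) (allFin x)))
        ≡⟨ sum-map-concatMap h (λ c → List.map (cons c) (allMaps n x)) (allFin x) ⟩
      sum (List.map (λ c → sum (List.map h (List.map (cons c) (allMaps n x)))) (allFin x))
        ≡⟨ sum-map-allFin {x} _ ⟩
      ∑[ c < x ] sum (List.map h (List.map (cons c) (allMaps n x)))
        ≡⟨ sum-cong-≗ {x} (λ c → cong sum (trans (sym (List.map-∘ (allMaps n x)))
                                                  (List.map-cong (ext ∘ cons≗insertAt c) (allMaps n x)))) ⟩
      ∑[ c < x ] sum (List.map (λ f → h (insertAt f zero c)) (allMaps n x))
        ≡⟨ sum-cong-≗ {x} (λ c → sum-map-allMaps n x (insertAt-zero-extensional ext c)) ⟩
      ∑Maps (suc n) x h ∎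
      where open ≡-Reasoning

  chromatic≡∑Maps : ∀ {n} (H : Graph n) x → chromatic H x ≡ ∑Maps n x (indicator ∘ isProper H)
  chromatic≡∑Maps {n} H x = trans (length-filter-≡true (isProper H) (allMaps n x))
                                  (sum-map-allMaps n x (cong indicator ∘ isProper-resp-≗ H))

  module _ {m} (G : Graph (suc m)) {u v : Fin (suc m)} (u≢v : u ≢ v) (u≁v : adj G u v ≡ false) where

    private
      separated sameColour : ∀ {x} → (Fin (suc m) → Fin x) → ℕ
      separated  c = indicator (isProper G c ∧ not (c u == c v))
      sameColour c = indicator (isProper G c ∧ (c u == c v))

    -- Summing over the colour c₀ of v last, c u = c v pins c₀ to the colour f ū of the merged vertex.
    ∑Maps-sameColour : ∀ x → ∑Maps (suc m) x sameColour ≡ chromatic (contract G u v u≢v) x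
    ∑Maps-sameColour x = begin
      ∑Maps (suc m) x sameColour
        ≡⟨ ∑Maps-insertAt m x v sameColour-extensional ⟩
      ∑[ c₀ < x ] ∑Maps m x (λ f → sameColour (insertAt f v c₀))
        ≡⟨ sum-cong-≗ {x} (λ c₀ → ∑Maps-cong m x λ f →
             cong (λ b → indicator (isProper G (insertAt f v c₀) ∧ b)) (colours-of-u-v f c₀)) ⟩
      ∑[ c₀ < x ] ∑Maps m x (λ f → term f c₀)
        ≡⟨ sym (∑Maps-comm m x term) ⟩
      ∑Maps m x (λ f → ∑[ c₀ < x ] term f c₀)
        ≡⟨ ∑Maps-cong m x (λ f → sum-single (term f) (f ū) (other-colours f)) ⟩
      ∑Maps m x (λ f → term f (f ū))
        ≡⟨ ∑Maps-cong m x (λ f → cong indicator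
             (trans (cong (isProper G (insertAt f v (f ū)) ∧_) (==-refl (f ū))) (∧-identityʳ _))) ⟩
      ∑Maps m x (λ f → indicator (isProper G (insertAt f v (f ū))))
        ≡⟨ ∑Maps-cong m x (λ f → cong indicator (isProper-contract G u≢v u≁v f)) ⟩
      ∑Maps m x (indicator ∘ isProper (contract G u v u≢v))
        ≡⟨ sym (chromatic≡∑Maps (contract G u v u≢v) x) ⟩
      chromatic (contract G u v u≢v) x ∎
      where
      open ≡-Reasoning
      ū : Fin m
      ū = merged u≢v
      term : (Fin m → Fin x) → Fin x → ℕ
      term f c₀ = indicator (isProper G (insertAt f v c₀) ∧ (f ū == c₀))
      sameColour-extensional : Extensional sameColour
      sameColour-extensional c≗d =
        cong₂ (λ b b′ → indicator (b ∧ b′)) (isProper-resp-≗ G c≗d) (cong₂ _==_ (c≗d u) (c≗d v))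
      colours-of-u-v : ∀ f c₀ → (insertAt f v c₀ u == insertAt f v c₀ v) ≡ (f ū == c₀)
      colours-of-u-v f c₀ = cong₂ _==_
        (trans (cong (insertAt f v c₀) (sym (punchIn-merged u≢v))) (insertAt-punchIn f v c₀ ū))
        (insertAt-lookup f v c₀)
      other-colours : ∀ f c₀ → c₀ ≢ f ū → term f c₀ ≡ 0
      other-colours f c₀ c₀≢fū =
        trans (cong (λ b → indicator (isProper G (insertAt f v c₀) ∧ b)) (==-≢ (c₀≢fū ∘ sym)))
              (cong indicator (∧-zeroʳ _))

    chromatic-deletion-contraction : ∀ x →
      chromatic G x ≡ chromatic (addEdge G u v) x + chromatic (contract G u v u≢v) x
    chromatic-deletion-contraction x = begin
      chromatic G x
        ≡⟨ chromatic≡∑Maps G x ⟩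
      ∑Maps (suc m) x (indicator ∘ isProper G)
        ≡⟨ ∑Maps-cong (suc m) x (λ c → indicator-split (isProper G c) (c u == c v)) ⟩
      ∑Maps (suc m) x (λ c → separated c + sameColour c)
        ≡⟨ ∑Maps-+ (suc m) x separated sameColour ⟩
      ∑Maps (suc m) x separated + ∑Maps (suc m) x sameColour
        ≡⟨ cong₂ _+_ (∑Maps-cong (suc m) x λ c → cong indicator (sym (isProper-addEdge G u≢v c)))
                     (∑Maps-sameColour x) ⟩
      ∑Maps (suc m) x (indicator ∘ isProper (addEdge G u v)) + chromatic (contract G u v u≢v) x
        ≡⟨ cong (_+ chromatic (contract G u v u≢v) x) (sym (chromatic≡∑Maps (addEdge G u v) x)) ⟩
      chromatic (addEdge G u v) x + chromatic (contract G u v u≢v) x ∎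
      where open ≡-Reasoning

open BinomialBasis
open Colourings using (chromatic-deletion-contraction)

mainTheorem7 : ∀ {m} (G : Graph (suc m)) (u v : Fin (suc m)) (u≢v : u ≢ v)
    → adj G u v ≡ false
    → (wG : Fin (suc (suc m)) → ℤ) → IsW G wG
    → (wG+ : Fin (suc (suc m)) → ℤ) → IsW (addEdge G u v) wG+
    → (wG· : Fin (suc m) → ℤ) → IsW (contract G u v u≢v) wG·
    → ∀ (i : ℕ) → wPoly wG i ≡ (wPoly wG+ ⊕ oneMinusX* (wPoly wG·)) i
mainTheorem7 {m} G u v u≢v u≁v wG isW wG+ isW+ wG· isW· =
  coefficients-of-mixed-sum (wPoly-degree wG) (wPoly-degree wG+) (wPoly-degree wG·) expansions-add
  where
  open import Data.Integer using (+_; _+_)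
  import Data.Integer.Properties as ℤ
  open ≡-Reasoning
  G+ : Graph (suc m)
  G+ = addEdge G u v
  G· : Graph m
  G· = contract G u v u≢v
  expansions-add : ∀ x →
    binomialSum (suc m) (wPoly wG) x ≡ binomialSum (suc m) (wPoly wG+) x + binomialSum m (wPoly wG·) x
  expansions-add x = begin
    binomialSum (suc m) (wPoly wG) x
      ≡⟨ sym (IsW⇒binomialSum G wG isW x) ⟩
    + chromatic G x
      ≡⟨ cong (λ n → + n) (chromatic-deletion-contraction G u≢v u≁v x) ⟩
    + (chromatic G+ x Data.Nat.+ chromatic G· x)
      ≡⟨ ℤ.pos-+ (chromatic G+ x) (chromatic G· x) ⟩
    + chromatic G+ x + + chromatic G· x
      ≡⟨ cong₂ _+_ (IsW⇒binomialSum G+ wG+ isW+ x) (IsW⇒binomialSum G· wG· isW· x) ⟩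
    binomialSum (suc m) (wPoly wG+) x + binomialSum m (wPoly wG·) x ∎
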